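{- Let $a,b,c$ be positive integers with $bc\equiv 1 \pmod 4$ such that $n=abc-a-b\ge 2$. Then the greedy-type algorithm for the Erdős–Straus decomposition converges for $n$.
   Context: Greedy-type algorithm for a positive integer $n\ge 2$: let $q=\lfloor n/4\rfloor$. For $j=1,2,3,\ldots$ set $x_j=q+j$, $\kappa_j=\frac4n-\frac1{x_j}$ (which is positive) and $y_j=\lceil 1/\kappa_j\rceil$. The algorithm stops at step $j$ if either $\frac4n-\frac1{x_j}-\frac1{y_j}=0$, or $z_j=\left(\frac4n-\frac1{x_j}-\frac1{y_j}\right)^{ -1}$ is a positive integer (in which case $\frac4n=\frac1{x_j}+\frac1{y_j}+\frac1{z_j}$); otherwise it proceeds to step $j+1$. The algorithm is said to converge for $n$ if it stops at some finite step $j$. -}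

module Defs where

open import Data.Nat using (ℕ; zero; suc; _+_; _*_; _∸_; _≤_; _<_)
open import Data.Nat.DivMod using (_/_)
open import Data.Nat.Divisibility using (_∣_)
open import Data.Product using (∃-syntax; _×_)
open import Data.Sum using (_⊎_)
open import Relation.Binary.PropositionalEquality using (_≡_)

-- Greedy-type algorithm for 4/n = 1/x + 1/y + 1/z, with all rational
-- quantities represented by numerators over explicit denominators.

-- ceiling division ⌈ a / d ⌉ for d > 0 (value 0 for d = 0, never used)
ceilDiv : ℕ → ℕ → ℕ
ceilDiv a zero    = 0
ceilDiv a (suc m) = (a + m) / suc m

q : ℕ → ℕ
q n = n / 4

xj : ℕ → ℕ → ℕ
xj n j = q n + j

-- κ_j = 4/n − 1/x_j = κnum n j / (n * x_j)   (κnum > 0 since x_j > n/4)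
κnum : ℕ → ℕ → ℕ
κnum n j = 4 * xj n j ∸ n

-- y_j = ⌈ 1/κ_j ⌉ = ⌈ n x_j / κnum ⌉
yj : ℕ → ℕ → ℕ
yj n j = ceilDiv (n * xj n j) (κnum n j)

-- 4/n − 1/x_j − 1/y_j = rnum n j / (n * x_j * y_j)   (rnum ≥ 0 since y_j ≥ 1/κ_j)
rnum : ℕ → ℕ → ℕ
rnum n j = κnum n j * yj n j ∸ n * xj n j

-- the algorithm stops at step j: either the remainder is 0, or its
-- reciprocal z_j = n x_j y_j / rnum is a positive integer
StopsAt : ℕ → ℕ → Set
StopsAt n j = rnum n j ≡ 0 ⊎ (0 < rnum n j × rnum n j ∣ n * xj n j * yj n j)

Converges : ℕ → Set
Converges n = ∃[ j ] (1 ≤ j × StopsAt n j)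

-- Write bc = 1 + 4m, so that n = 4am − b, and put x = am(ac − 1), y = am.  Then
-- 4xy = nx + ny + a²m, i.e. 4/n = 1/x + 1/y + 1/z with z = nxy / a²m = nm(ac − 1).
-- The remainder a²m is smaller than 4x − n, so y = ⌈nx / (4x − n)⌉ is exactly the greedy
-- choice at the step with x_j = x.  That bound follows from a + 8 ≤ 4ac, which fails only
-- for (a, c) ∈ {(1, 1), (1, 2), (2, 1)}: the first forces n < 0, the second makes bc even,
-- and in the third b = 1 + 4m and the bound is checked directly.
module Submission where

open import Defs
open import Data.Nat using (ℕ; zero; suc; _+_; _*_; _∸_; _≤_; _<_; z≤n; s≤s)
open import Data.Nat.DivMod using (_%_; _/_; m≡m%n+[m/n]*n; [m+kn]%n≡m%n; m*n%n≡0;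
  +-distrib-/-∣ʳ; m<n⇒m/n≡0; m*n/n≡m; m<n*o⇒m/o<n)
open import Data.Nat.Divisibility using (_∣_; divides; divides-refl)
open import Data.Nat.Properties
open import Data.Nat.Tactic.RingSolver using (solve)
open import Data.List using (_∷_; [])
open import Data.Product using (_,_; _×_)
open import Data.Sum using (_⊎_; inj₁; inj₂)
open import Relation.Binary.PropositionalEquality
open import Function using (_∋_)
open import Data.Empty using (⊥-elim)

ceilDiv-exact : ∀ N {k y r} → N + r ≡ k * y → r < k → ceilDiv N k ≡ y
ceilDiv-exact N {suc k} {y} {r} N+r≡ky (s≤s r≤k) = begin
  (N + k) / suc k                          ≡⟨ cong (_/ suc k) N+k≡ ⟩
  ((k ∸ r) + y * suc k) / suc k            ≡⟨ +-distrib-/-∣ʳ (k ∸ r) (divides-refl y) ⟩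
  (k ∸ r) / suc k + y * suc k / suc k      ≡⟨ cong₂ _+_ (m<n⇒m/n≡0 (s≤s (m∸n≤m k r))) (m*n/n≡m y (suc k)) ⟩
  y                                        ∎
  where
  open ≡-Reasoning
  N+k≡ : N + k ≡ (k ∸ r) + y * suc k
  N+k≡ = begin
    N + k                ≡⟨ cong (N +_) (sym (m+[n∸m]≡n r≤k)) ⟩
    N + (r + (k ∸ r))    ≡⟨ sym (+-assoc N r (k ∸ r)) ⟩
    N + r + (k ∸ r)      ≡⟨ cong (_+ (k ∸ r)) (trans N+r≡ky (*-comm (suc k) y)) ⟩
    y * suc k + (k ∸ r)  ≡⟨ +-comm (y * suc k) (k ∸ r) ⟩
    (k ∸ r) + y * suc k  ∎

greedyY : ℕ → ℕ → ℕ
greedyY n x = ceilDiv (n * x) (4 * x ∸ n)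

greedyRemainder : ℕ → ℕ → ℕ
greedyRemainder n x = (4 * x ∸ n) * greedyY n x ∸ n * x

-- StopsAt n j unfolds to StopsAtX n (xj n j).
StopsAtX : ℕ → ℕ → Set
StopsAtX n x = greedyRemainder n x ≡ 0
             ⊎ (0 < greedyRemainder n x × greedyRemainder n x ∣ n * x * greedyY n x)

zero-or-positive-divisor : ∀ {r N} → r ∣ N → r ≡ 0 ⊎ (0 < r × r ∣ N)
zero-or-positive-divisor {zero}  _   = inj₁ refl
zero-or-positive-divisor {suc r} r∣N = inj₂ (s≤s z≤n , r∣N)

stopsAtX : ∀ n x y r → n * x + r ≡ (4 * x ∸ n) * y → r < 4 * x ∸ n → r ∣ n * x * y → StopsAtX n x
stopsAtX n x y r nx+r≡ky r<k r∣nxy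
  rewrite ceilDiv-exact (n * x) nx+r≡ky r<k | sym nx+r≡ky | m+n∸m≡n (n * x) r = zero-or-positive-divisor r∣nxy

greedy-converges : ∀ n x y r → n * x + r + n * y ≡ 4 * x * y → r + n < 4 * x → r ∣ n * x * y
                 → Converges n
greedy-converges n x y r nx+r+ny≡4xy r+n<4x r∣nxy =
  x ∸ q n , m<n⇒0<n∸m q<x , subst (StopsAtX n) (sym (m+[n∸m]≡n (<⇒≤ q<x))) (stopsAtX n x y r nx+r≡ky r<k r∣nxy)
  where
  open ≡-Reasoning
  n<4x : n < 4 * x
  n<4x = ≤-<-trans (m≤n+m n r) r+n<4x
  q<x : q n < x
  q<x = m<n*o⇒m/o<n (subst (n <_) (*-comm 4 x) n<4x)
  k+n≡4x : 4 * x ∸ n + n ≡ 4 * x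
  k+n≡4x = m∸n+n≡m (<⇒≤ n<4x)
  r<k : r < 4 * x ∸ n
  r<k = +-cancelʳ-< n r (4 * x ∸ n) (subst (r + n <_) (sym k+n≡4x) r+n<4x)
  nx+r≡ky : n * x + r ≡ (4 * x ∸ n) * y
  nx+r≡ky = +-cancelʳ-≡ (n * y) _ _ (begin
    n * x + r + n * y          ≡⟨ nx+r+ny≡4xy ⟩
    4 * x * y                  ≡⟨ cong (_* y) (sym k+n≡4x) ⟩
    (4 * x ∸ n + n) * y        ≡⟨ *-distribʳ-+ y (4 * x ∸ n) n ⟩
    (4 * x ∸ n) * y + n * y    ∎)

erdos-straus-identity : ∀ n a b c m e → n + b ≡ 4 * (a * m) → b * c ≡ 1 + 4 * m → a * c ≡ 1 + e
                      → n * (a * m * e) + a * a * m + n * (a * m) ≡ 4 * (a * m * e) * (a * m)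
erdos-straus-identity n a b c m e n+b≡4am bc≡1+4m ac≡1+e =
  +-cancelʳ-≡ (b * (a * m) * (1 + e)) _ _ (begin
    n * (a * m * e) + a * a * m + n * (a * m) + b * (a * m) * (1 + e)
      ≡⟨ solve (n ∷ a ∷ b ∷ m ∷ e ∷ []) ⟩
    (n + b) * (a * m) * (1 + e) + a * a * m
      ≡⟨ cong (λ t → t * (a * m) * (1 + e) + a * a * m) n+b≡4am ⟩
    4 * (a * m) * (a * m) * (1 + e) + a * a * m
      ≡⟨ solve (a ∷ m ∷ e ∷ []) ⟩
    4 * (a * m * e) * (a * m) + a * a * m * (1 + 4 * m)
      ≡⟨ cong (λ t → 4 * (a * m * e) * (a * m) + a * a * m * t) (sym bc≡1+4m) ⟩
    4 * (a * m * e) * (a * m) + a * a * m * (b * c)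
      ≡⟨ solve (a ∷ b ∷ c ∷ m ∷ e ∷ []) ⟩
    4 * (a * m * e) * (a * m) + b * (a * m) * (a * c)
      ≡⟨ cong (λ t → 4 * (a * m * e) * (a * m) + b * (a * m) * t) ac≡1+e ⟩
    4 * (a * m * e) * (a * m) + b * (a * m) * (1 + e) ∎)
  where open ≡-Reasoning

remainder-gap-large : ∀ a b c m e → a * c ≡ 1 + e → 0 < b → a + 8 ≤ 4 * (a * c)
                      → a * a * m + 4 * (a * m) < 4 * (a * m * e) + b
remainder-gap-large a b c m e ac≡1+e 0<b a+8≤4ac = begin-strict
  a * a * m + 4 * (a * m)   ≡⟨ solve (a ∷ m ∷ []) ⟩
  a * m * (a + 4) + 0       <⟨ +-mono-≤-< (*-monoʳ-≤ (a * m) a+4≤4e) 0<b ⟩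
  a * m * (4 * e) + b       ≡⟨ cong (_+ b) (solve (a ∷ m ∷ e ∷ [])) ⟩
  4 * (a * m * e) + b       ∎
  where
  open ≤-Reasoning
  a+4≤4e : a + 4 ≤ 4 * e
  a+4≤4e = +-cancelʳ-≤ 4 (a + 4) (4 * e) (begin
    a + 4 + 4        ≡⟨ +-assoc a 4 4 ⟩
    a + 8            ≤⟨ a+8≤4ac ⟩
    4 * (a * c)      ≡⟨ cong (4 *_) ac≡1+e ⟩
    4 * (1 + e)      ≡⟨ solve (e ∷ []) ⟩
    4 * e + 4        ∎)

even≢1+4* : ∀ b m → b * 2 ≢ 1 + 4 * m
even≢1+4* b m eq = 0≢1+n {0} (begin
  0                     ≡⟨ sym (m*n%n≡0 b 2) ⟩
  b * 2 % 2             ≡⟨ cong (_% 2) eq ⟩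
  (1 + 4 * m) % 2       ≡⟨ cong (λ t → (1 + t) % 2) (4 * m ≡ 2 * m * 2 ∋ solve (m ∷ [])) ⟩
  (1 + (2 * m) * 2) % 2 ≡⟨ [m+kn]%n≡m%n 1 (2 * m) 2 ⟩
  1                     ∎)
  where open ≡-Reasoning

remainder-gap : ∀ n a b c m e → n + b ≡ 4 * (a * m) → b * c ≡ 1 + 4 * m → a * c ≡ 1 + e → 0 < b
             → a * a * m + 4 * (a * m) < 4 * (a * m * e) + b
remainder-gap n zero b c m e _ _ () _
remainder-gap n a b zero m e _ _ ac≡1+e _ = ⊥-elim (0≢1+n (trans (sym (*-zeroʳ a)) ac≡1+e))
remainder-gap n 1 b 1 m e n+b≡4m b≡1+4m _ _ = ⊥-elim (<-irrefl refl (begin-strict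
  4 * m      <⟨ n<1+n (4 * m) ⟩
  1 + 4 * m  ≡⟨ sym b≡1+4m ⟩
  b * 1      ≡⟨ *-identityʳ b ⟩
  b          ≤⟨ m≤n+m b n ⟩
  n + b      ≡⟨ n+b≡4m ⟩
  4 * (1 * m) ≡⟨ cong (4 *_) (*-identityˡ m) ⟩
  4 * m      ∎))
  where open ≤-Reasoning
remainder-gap n 1 b 2 m e _ b2≡1+4m _ _ = ⊥-elim (even≢1+4* b m b2≡1+4m)
remainder-gap n 1 b (suc (suc (suc c))) m e _ _ ac≡1+e 0<b =
  remainder-gap-large 1 b (3 + c) m e ac≡1+e 0<b (begin
    9                      ≤⟨ m≤m+n 9 (3 + 4 * c) ⟩
    9 + (3 + 4 * c)        ≡⟨ solve (c ∷ []) ⟩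
    4 * (1 * (3 + c))      ∎)
  where open ≤-Reasoning
remainder-gap n 2 b 1 m .1 _ b≡1+4m refl _ = ≤-reflexive (begin
  1 + (2 * 2 * m + 4 * (2 * m)) ≡⟨ solve (m ∷ []) ⟩
  4 * (2 * m * 1) + (1 + 4 * m) ≡⟨ cong (4 * (2 * m * 1) +_) (trans (sym b≡1+4m) (*-identityʳ b)) ⟩
  4 * (2 * m * 1) + b           ∎)
  where open ≡-Reasoning
remainder-gap n 2 b (suc (suc c)) m e _ _ ac≡1+e 0<b =
  remainder-gap-large 2 b (2 + c) m e ac≡1+e 0<b (begin
    10                     ≤⟨ m≤m+n 10 (6 + 8 * c) ⟩
    10 + (6 + 8 * c)       ≡⟨ solve (c ∷ []) ⟩
    4 * (2 * (2 + c))      ∎)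
  where open ≤-Reasoning
remainder-gap n (suc (suc (suc a))) b (suc c) m e _ _ ac≡1+e 0<b =
  remainder-gap-large (3 + a) b (1 + c) m e ac≡1+e 0<b (begin
    3 + a + 8                                 ≤⟨ m≤m+n (3 + a + 8) (1 + 3 * a + 4 * (3 + a) * c) ⟩
    3 + a + 8 + (1 + 3 * a + 4 * (3 + a) * c) ≡⟨ solve (a ∷ c ∷ []) ⟩
    4 * ((3 + a) * (1 + c))                   ∎)
  where open ≤-Reasoning

remainder-bound : ∀ n a b c m e → n + b ≡ 4 * (a * m) → b * c ≡ 1 + 4 * m → a * c ≡ 1 + e → 0 < b
                → a * a * m + n < 4 * (a * m * e)
remainder-bound n a b c m e n+b≡4am bc≡1+4m ac≡1+e 0<b =
  +-cancelʳ-< b (a * a * m + n) (4 * (a * m * e)) (begin-strict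
    a * a * m + n + b         ≡⟨ +-assoc (a * a * m) n b ⟩
    a * a * m + (n + b)       ≡⟨ cong (a * a * m +_) n+b≡4am ⟩
    a * a * m + 4 * (a * m)   <⟨ remainder-gap n a b c m e n+b≡4am bc≡1+4m ac≡1+e 0<b ⟩
    4 * (a * m * e) + b       ∎)
  where open ≤-Reasoning

erdos-straus-converges : ∀ n a b c m e → n + b ≡ 4 * (a * m) → b * c ≡ 1 + 4 * m → a * c ≡ 1 + e
                       → 0 < b → Converges n
erdos-straus-converges n a b c m e n+b≡4am bc≡1+4m ac≡1+e 0<b =
  greedy-converges n (a * m * e) (a * m) (a * a * m)
    (erdos-straus-identity n a b c m e n+b≡4am bc≡1+4m ac≡1+e)
    (remainder-bound n a b c m e n+b≡4am bc≡1+4m ac≡1+e 0<b)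
    (divides (n * m * e) (solve (n ∷ a ∷ m ∷ e ∷ [])))

lemma5p1 : (a b c : ℕ) → 0 < a → 0 < b → 0 < c → (b * c) % 4 ≡ 1
    → 2 ≤ a * b * c ∸ a ∸ b → Converges (a * b * c ∸ a ∸ b)
lemma5p1 a b c 0<a 0<b 0<c bc%4≡1 2≤n =
  erdos-straus-converges n a b c m (a * c ∸ 1) n+b≡4am bc≡1+4m ac≡1+e 0<b
  where
  open ≡-Reasoning
  n = a * b * c ∸ a ∸ b
  m = b * c / 4
  bc≡1+4m : b * c ≡ 1 + 4 * m
  bc≡1+4m = trans (m≡m%n+[m/n]*n (b * c) 4) (cong₂ _+_ bc%4≡1 (*-comm m 4))
  ac≡1+e : a * c ≡ 1 + (a * c ∸ 1)
  ac≡1+e = sym (m+[n∸m]≡n (*-mono-< 0<a 0<c))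
  n+b≡4am : n + b ≡ 4 * (a * m)
  n+b≡4am = begin
    n + b                  ≡⟨ m∸n+n≡m (<⇒≤ (m∸n≢0⇒n<m {a * b * c ∸ a} {b} (m<n⇒n≢0 2≤n))) ⟩
    a * b * c ∸ a          ≡⟨ cong (_∸ a) (trans (*-assoc a b c) (cong (a *_) bc≡1+4m)) ⟩
    a * (1 + 4 * m) ∸ a    ≡⟨ cong (_∸ a) (*-suc a (4 * m)) ⟩
    a + a * (4 * m) ∸ a    ≡⟨ m+n∸m≡n a (a * (4 * m)) ⟩
    a * (4 * m)            ≡⟨ sym (*-assoc a 4 m) ⟩
    a * 4 * m              ≡⟨ cong (_* m) (*-comm a 4) ⟩
    4 * a * m              ≡⟨ *-assoc 4 a m ⟩
    4 * (a * m)            ∎
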